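{- For every KAB $\mathcal K=\langle T,A_0,\Gamma,\Pi\rangle$, we have $\Upsilon^S_{\mathcal K}\sim_E\Upsilon^{f_S}_{\tau_K(\mathcal K)}$, where $\tau_K(\mathcal K)=\langle T,A_0,\Gamma,\delta\rangle$ with $\delta=\mathbf{while}\ \mathsf{true}\ \mathbf{do}\ (a_1\mid\cdots\mid a_n)$, $\Pi=\{Q_i(\vec x_i)\mapsto\alpha_i(\vec x_i)\}_{i=1}^n$ and $a_i=\mathbf{pick}\ Q_i(\vec x_i).\alpha_i(\vec x_i)$.
   Context: Fix a countably infinite set $\Delta$ of constants, a finite subset $\Delta_0\subset\Delta$, and a finite set of function symbols (service calls); a ground skolem term is $f(c_1,\dots,c_k)$ with $c_i\in\Delta$. KBs are DL-Lite$_{\mathcal A}$ KBs $\langle T,A\rangle$; $A$ is $T$-consistent if $\langle T,A\rangle$ is satisfiable. ECQs: $Q::=[q]\mid\neg Q\mid Q_1\wedge Q_2\mid\exists x.Q$ ($q$ a UCQ, $[q]$ evaluated by certain answers over $\langle T,A\rangle$); $\mathrm{ASK}(Q,T,A)$ is the set of certain answers (a truth value if boolean); $\mathsf{true}$ is the trivially true query. Actions $\alpha(\vec p)$: finite sets of effects $[q^+]\wedge Q^-\rightsquigarrow\mathbf{add}\,F^+,\mathbf{del}\,F^-$ ($q^+$ UCQ, $Q^-$ ECQ, $F^+$ atoms over constants, parameters, free variables of $q^+$ and skolem terms over these; $F^-$ atoms over constants, parameters, free variables of $q^+$). For ABox $A$ and parameter substitution $\sigma$: $\mathrm{ADD}(T,A,\alpha\sigma)=\bigcup_{\text{effects}}\bigcup_{\rho\in\mathrm{ASK}(([q^+]\wedge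 Q^-)\sigma,T,A)}F^+\sigma\rho$, $\mathrm{DEL}$ likewise with $F^-$; $\mathrm{EVAL}$ = total functions from ground skolem terms in $\mathrm{ADD}$ to $\Delta$. A service call map $m$ is a partial function from ground skolem terms to $\Delta$. $\langle A,m\rangle\xrightarrow{\alpha\sigma}\langle A',m'\rangle$ iff $A$ is $T$-consistent, some $\theta\in\mathrm{EVAL}$ agrees with $m$ on common domain, $m'=m\cup\theta$, $A'=(A\setminus\mathrm{DEL}(T,A,\alpha\sigma))\cup\mathrm{ADD}(T,A,\alpha\sigma)\theta$, and $A'$ is $T$-consistent. KB transition system: $\langle\Delta,T,\Sigma,s_0,\mathit{abox},\Rightarrow\rangle$. KAB $\langle T,A_0,\Gamma,\Pi\rangle$ ($\langle T,A_0\rangle$ satisfiable, $\Pi$ finite set of rules $Q(\vec x)\mapsto\alpha(\vec x)$, $\alpha\in\Gamma$): $\Upsilon^S_{\mathcal K}$ has states $\langle A,m\rangle$, $\mathit{abox}(\langle A,m\rangle)=A$, initial $\langle A_0,\emptyset\rangle$, and is least closed under $\langle A,m\rangle\Rightarrow\langle A',m'\rangle$ whenever a rule and $\sigma$ with $\mathrm{ASK}(Q\sigma,T,A)=\mathsf{true}$ give $\langle A,m\rangle\xrightarrow{\alpha\sigma}\langle A',m'\rangle$. Golog programs: $\delta::=\varepsilon\mid\mathbf{pick}\,Q(\vec p).\alpha(\vec p)\mid\delta_1|\delta_2\mid\delta_1;\delta_2\mid\mathbf{if}\,\varphi\,\mathbf{then}\,\delta_1\,\mathbf{else}\,\delta_2\mid\mathbf{while}\,\varphi\,\mathbf{do}\,\delta$.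 S-GKAB $\langle T,A_0,\Gamma,\delta\rangle$. Final states: least set containing $\langle A,m,\varepsilon\rangle$; $\langle A,m,\delta_1|\delta_2\rangle$ if one branch final; $\langle A,m,\delta_1;\delta_2\rangle$ if both final; if-then-else final if the branch selected by $\mathrm{ASK}(\varphi,T,A)$ is final; $\langle A,m,\mathbf{while}\,\varphi\,\mathbf{do}\,\delta\rangle$ if $\varphi$ false, or $\varphi$ true and $\langle A,m,\delta\rangle$ final. Execution relation: $\langle A,m,\mathbf{pick}\,Q(\vec p).\alpha(\vec p)\rangle\to\langle A',m',\varepsilon\rangle$ if $\mathrm{ASK}(Q\sigma,T,A)=\mathsf{true}$ and $\langle A,m\rangle\xrightarrow{\alpha\sigma}\langle A',m'\rangle$; $\delta_1|\delta_2\to\delta'$ if $\delta_1\to\delta'$ or $\delta_2\to\delta'$; $\delta_1;\delta_2\to\delta_1';\delta_2$ if $\delta_1\to\delta_1'$; $\delta_1;\delta_2\to\delta_2'$ if $\langle A,m,\delta_1\rangle$ final and $\delta_2\to\delta_2'$; if-then-else steps as the branch selected by $\varphi$; $\mathbf{while}\,\varphi\,\mathbf{do}\,\delta\to\delta';\mathbf{while}\,\varphi\,\mathbf{do}\,\delta$ if $\varphi$ true and $\delta\to\delta'$ (data part carried along). $\Upsilon^{f_S}_{\mathcal G}$: initial $\langle A_0,\emptyset,\delta\rangle$, $\mathit{abox}(\langle A,m,\delta\rangle)=A$, least system closed under the execution relation. E-bisimulation between $\Upsilon_1,\Upsilon_2$: $B\subseteq\Sigma_1\times\Sigma_2$ such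 that $(s_1,s_2)\in B$ implies $\mathit{abox}_1(s_1)=\mathit{abox}_2(s_2)$, every $s_1\Rightarrow_1 s_1'$ is matched by some $s_2\Rightarrow_2 s_2'$ with $(s_1',s_2')\in B$, and vice versa. $\Upsilon_1\sim_E\Upsilon_2$ iff some E-bisimulation contains the pair of initial states. -}

module Defs where

open import Level using (Lift)
open import Data.Nat using (ℕ; suc)
open import Data.Fin using (Fin)
open import Data.Vec using (Vec; _∷_; [])
import Data.Vec as Vec
open import Data.List using (List; _∷_; []; map)
open import Data.List.Membership.Propositional using (_∈_)
open import Data.List.Relation.Unary.Any using (Any)
open import Data.List.Relation.Unary.All using (All)
open import Data.Product using (Σ; _×_; _,_; proj₁; proj₂)
open import Data.Sum using (_⊎_)
open import Data.Empty using (⊥)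
open import Relation.Nullary using (¬_)
open import Relation.Binary.PropositionalEquality using (_≡_; _≢_)

-- Constants Δ are ℕ (a countably infinite set).  The finite set of
-- function symbols (service calls) is Fin nF, with arities ar.

module DL (nF : ℕ) (ar : Fin nF → ℕ) where

  data BRole : Set where
    rname : ℕ → BRole
    rinv  : ℕ → BRole

  roleName : BRole → ℕ
  roleName (rname p) = p
  roleName (rinv p)  = p

  data BConcept : Set where
    cname : ℕ → BConcept
    cex   : BRole → BConcept

  data GConcept : Set where
    cpos : BConcept → GConcept
    cneg : BConcept → GConcept

  data GRole : Set where
    rpos : BRole → GRole
    rneg : BRole → GRole

  data TAx : Set where
    cincl : BConcept → GConcept → TAx
    rincl : BRole → GRole → TAx
    funct : BRole → TAx

  TBox : Set
  TBox = List TAx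

  -- DL-Lite_A restriction: a role occurring in a functionality assertion
  -- is not specialized (does not occur positively on the rhs of a role
  -- inclusion).
  WellFormedTBox : TBox → Set
  WellFormedTBox T = ∀ {R S S'} → funct R ∈ T → rincl S (rpos S') ∈ T →
                     roleName S' ≢ roleName R

  data Atom (X : Set) : Set where
    cAt : ℕ → X → Atom X
    rAt : ℕ → X → X → Atom X

  GAtom : Set
  GAtom = Atom ℕ

  record Interp : Set₁ where
    field
      Dom  : Set
      cI   : ℕ → Dom
      una  : ∀ {c d} → cI c ≡ cI d → c ≡ d
      cN   : ℕ → Dom → Set
      rN   : ℕ → Dom → Dom → Set

  module _ (I : Interp) where
    open Interp I

    roleI : BRole → Dom → Dom → Set
    roleI (rname p) x y = rN p x y
    roleI (rinv p)  x y = rN p y x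

    conceptI : BConcept → Dom → Set
    conceptI (cname a) x = cN a x
    conceptI (cex R)   x = Σ Dom λ y → roleI R x y

    gconceptI : GConcept → Dom → Set
    gconceptI (cpos B) x = conceptI B x
    gconceptI (cneg B) x = ¬ conceptI B x

    groleI : GRole → Dom → Dom → Set
    groleI (rpos R) x y = roleI R x y
    groleI (rneg R) x y = ¬ roleI R x y

    satAx : TAx → Set
    satAx (cincl B C) = ∀ x → conceptI B x → gconceptI C x
    satAx (rincl R E) = ∀ x y → roleI R x y → groleI E x y
    satAx (funct R)   = ∀ x y z → roleI R x y → roleI R x z → y ≡ z

    satGAtom : GAtom → Set
    satGAtom (cAt a c)   = cN a (cI c)
    satGAtom (rAt p c d) = rN p (cI c) (cI d)

  ABox : Set₂
  ABox = GAtom → Set₁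

  listABox : List GAtom → ABox
  listABox A a = Lift _ (a ∈ A)

  Model : Interp → TBox → ABox → Set₁
  Model I T A = (∀ ax → ax ∈ T → satAx I ax) × (∀ a → A a → satGAtom I a)

  Consistent : TBox → ABox → Set₁
  Consistent T A = Σ Interp λ I → Model I T A

  -- Queries.  np = number of parameters (action/rule parameters),
  -- k = number of free (answer) variables, m = existential variables.

  data QTerm (np k m : ℕ) : Set where
    qc : ℕ → QTerm np k m
    qp : Fin np → QTerm np k m
    qf : Fin k → QTerm np k m
    qe : Fin m → QTerm np k m

  record CQ (np k : ℕ) : Set where
    constructor cq
    field
      nex  : ℕ
      body : List (Atom (QTerm np k nex))

  UCQ : ℕ → ℕ → Set
  UCQ np k = List (CQ np k)

  -- ECQs; de Bruijn-style: ∃ binds free variable 0.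
  data ECQ (np : ℕ) : ℕ → Set where
    ⟦_⟧  : ∀ {n} → UCQ np n → ECQ np n
    ¬E   : ∀ {n} → ECQ np n → ECQ np n
    _∧E_ : ∀ {n} → ECQ np n → ECQ np n → ECQ np n
    ∃E   : ∀ {n} → ECQ np (suc n) → ECQ np n

  trueQ : ∀ {np} → ECQ np 0
  trueQ = ⟦ cq 0 [] ∷ [] ⟧

  module _ (I : Interp) where
    open Interp I

    evalQT : ∀ {np k m} → (Fin np → ℕ) → (Fin k → ℕ) → (Fin m → Dom) →
             QTerm np k m → Dom
    evalQT σ ρ η (qc c) = cI c
    evalQT σ ρ η (qp i) = cI (σ i)
    evalQT σ ρ η (qf j) = cI (ρ j)
    evalQT σ ρ η (qe e) = η e

    satQAtom : ∀ {np k m} → (Fin np → ℕ) → (Fin k → ℕ) → (Fin m → Dom) →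
               Atom (QTerm np k m) → Set
    satQAtom σ ρ η (cAt a t)    = cN a (evalQT σ ρ η t)
    satQAtom σ ρ η (rAt p t t') = rN p (evalQT σ ρ η t) (evalQT σ ρ η t')

    satCQ : ∀ {np k} → (Fin np → ℕ) → (Fin k → ℕ) → CQ np k → Set
    satCQ σ ρ (cq m body) = Σ (Fin m → Dom) λ η → All (satQAtom σ ρ η) body

    satUCQ : ∀ {np k} → (Fin np → ℕ) → (Fin k → ℕ) → UCQ np k → Set
    satUCQ σ ρ q = Any (satCQ σ ρ) q

  Cert : ∀ {np k} → TBox → ABox → UCQ np k → (Fin np → ℕ) → (Fin k → ℕ) → Set₁
  Cert T A q σ ρ = ∀ (I : Interp) → Model I T A → satUCQ I σ ρ q

  -- ρ ∈ ASK(Qσ,T,A)  (ECQ semantics; ∃ ranges over the constants Δ)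
  Holds : ∀ {np n} → TBox → ABox → ECQ np n → (Fin np → ℕ) → (Fin n → ℕ) → Set₁
  Holds T A ⟦ q ⟧      σ ρ = Cert T A q σ ρ
  Holds T A (¬E Q)     σ ρ = ¬ Holds T A Q σ ρ
  Holds T A (Q₁ ∧E Q₂) σ ρ = Holds T A Q₁ σ ρ × Holds T A Q₂ σ ρ
  Holds T A (∃E Q)     σ ρ = Σ ℕ λ c → Holds T A Q σ (Data.Vec.lookup (c ∷ Vec.tabulate ρ))

  AskTrue : ∀ {np} → TBox → ABox → ECQ np 0 → (Fin np → ℕ) → Set₁
  AskTrue T A Q σ = Holds T A Q σ (λ ())

  data BTerm (np k : ℕ) : Set where
    bc : ℕ → BTerm np k
    bp : Fin np → BTerm np k
    bv : Fin k → BTerm np k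

  data ETerm (np k : ℕ) : Set where
    bt : BTerm np k → ETerm np k
    sk : (f : Fin nF) → Vec (BTerm np k) (ar f) → ETerm np k

  record Effect (np : ℕ) : Set where
    field
      k      : ℕ
      qplus  : UCQ np k
      qminus : ECQ np k
      addF   : List (Atom (ETerm np k))
      delF   : List (Atom (BTerm np k))

  record Action : Set where
    constructor action
    field
      np      : ℕ
      effects : List (Effect np)
  open Action public

  GSk : Set
  GSk = Σ (Fin nF) λ f → Vec ℕ (ar f)

  data GETerm : Set where
    gc : ℕ → GETerm
    gs : GSk → GETerm

  mapAtom : ∀ {X Y : Set} → (X → Y) → Atom X → Atom Y
  mapAtom f (cAt a t)    = cAt a (f t)
  mapAtom f (rAt p t t') = rAt p (f t) (f t')

  instB : ∀ {np k} → (Fin np → ℕ) → (Fin k → ℕ) → BTerm np k → ℕ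
  instB σ ρ (bc c) = c
  instB σ ρ (bp i) = σ i
  instB σ ρ (bv j) = ρ j

  instE : ∀ {np k} → (Fin np → ℕ) → (Fin k → ℕ) → ETerm np k → GETerm
  instE σ ρ (bt b)    = gc (instB σ ρ b)
  instE σ ρ (sk f ts) = gs (f , Vec.map (instB σ ρ) ts)

  ADD : TBox → ABox → (α : Action) → (Fin (np α) → ℕ) → Atom GETerm → Set₁
  ADD T A α σ a =
    Σ (Effect (np α)) λ e → e ∈ effects α ×
      Σ (Fin (Effect.k e) → ℕ) λ ρ →
        Holds T A (⟦ Effect.qplus e ⟧ ∧E Effect.qminus e) σ ρ ×
        Σ (Atom (ETerm (np α) (Effect.k e))) λ f → f ∈ Effect.addF e ×
          mapAtom (instE σ ρ) f ≡ a

  DEL : TBox → ABox → (α : Action) → (Fin (np α) → ℕ) → GAtom → Set₁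
  DEL T A α σ a =
    Σ (Effect (np α)) λ e → e ∈ effects α ×
      Σ (Fin (Effect.k e) → ℕ) λ ρ →
        Holds T A (⟦ Effect.qplus e ⟧ ∧E Effect.qminus e) σ ρ ×
        Σ (Atom (BTerm (np α) (Effect.k e))) λ f → f ∈ Effect.delF e ×
          mapAtom (instB σ ρ) f ≡ a

  OccT : GSk → GETerm → Set
  OccT t (gc _) = ⊥
  OccT t (gs s) = s ≡ t

  OccA : GSk → Atom GETerm → Set
  OccA t (cAt _ x)   = OccT t x
  OccA t (rAt _ x y) = OccT t x ⊎ OccT t y

  SkOfADD : TBox → ABox → (α : Action) → (Fin (np α) → ℕ) → GSk → Set₁
  SkOfADD T A α σ t = Σ (Atom GETerm) λ a → ADD T A α σ a × OccA t a

  groundE : (GSk → ℕ) → GETerm → ℕ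
  groundE θ (gc c) = c
  groundE θ (gs s) = θ s

  -- service call maps: partial functions GSk ⇀ Δ, given by their graph
  SMap : Set₂
  SMap = GSk → ℕ → Set₁

  emptyMap : SMap
  emptyMap _ _ = Lift _ ⊥

  -- ⟨A,m⟩ --ασ--> ⟨A',m'⟩.  A θ ∈ EVAL is represented by a total
  -- function GSk → ℕ, of which only the restriction to the skolem
  -- terms of ADD matters.
  Step : TBox → ABox → SMap → (α : Action) → (Fin (np α) → ℕ) →
         ABox → SMap → Set₂
  Step T A m α σ A' m' =
    Consistent T A ×
    Σ (GSk → ℕ) λ θ →
      (∀ t d → SkOfADD T A α σ t → m t d → θ t ≡ d) ×
      (m' ≡ (λ t d → m t d ⊎ (SkOfADD T A α σ t × θ t ≡ d))) ×
      (A' ≡ (λ a → (A a × ¬ DEL T A α σ a) ⊎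
                   (Σ (Atom GETerm) λ b → ADD T A α σ b × mapAtom (groundE θ) b ≡ a))) ×
      Consistent T A'

  record KBTS : Set₃ where
    field
      tbox  : TBox
      St    : Set₂
      abox  : St → ABox
      s0    : St
      _⇒_   : St → St → Set₂

  -- the least transition system generated from s0: states reachable from s0
  data Reach {S : Set₂} (s0 : S) (R : S → S → Set₂) : S → Set₂ where
    here : Reach s0 R s0
    next : ∀ {s s'} → Reach s0 R s → R s s' → Reach s0 R s'

  reachTS : TBox → (S : Set₂) → (S → ABox) → S → (S → S → Set₂) → KBTS
  reachTS T S ab s0 R = record
    { tbox = T
    ; St   = Σ S (Reach s0 R)
    ; abox = λ s → ab (proj₁ s)
    ; s0   = s0 , here
    ; _⇒_  = λ s s' → R (proj₁ s) (proj₁ s')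
    }

  record IsEBisim (Υ₁ Υ₂ : KBTS) (B : KBTS.St Υ₁ → KBTS.St Υ₂ → Set₂) : Set₂ where
    module U₁ = KBTS Υ₁
    module U₂ = KBTS Υ₂
    field
      aboxEq : ∀ {s₁ s₂} → B s₁ s₂ → U₁.abox s₁ ≡ U₂.abox s₂
      forth  : ∀ {s₁ s₂ s₁'} → B s₁ s₂ → U₁._⇒_ s₁ s₁' →
               Σ U₂.St λ s₂' → U₂._⇒_ s₂ s₂' × B s₁' s₂'
      back   : ∀ {s₁ s₂ s₂'} → B s₁ s₂ → U₂._⇒_ s₂ s₂' →
               Σ U₁.St λ s₁' → U₁._⇒_ s₁ s₁' × B s₁' s₂'

  _∼E_ : KBTS → KBTS → Set₃
  Υ₁ ∼E Υ₂ = Σ (KBTS.St Υ₁ → KBTS.St Υ₂ → Set₂) λ B →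
               IsEBisim Υ₁ Υ₂ B × B (KBTS.s0 Υ₁) (KBTS.s0 Υ₂)

  -- rule Q(x⃗) ↦ α(x⃗): the action together with a boolean ECQ over its
  -- parameters x⃗
  Rule : Set
  Rule = Σ Action λ α → ECQ (np α) 0

  record KAB : Set₁ where
    field
      T    : TBox
      A₀   : List GAtom
      Γ    : List Action
      Π    : List Rule
      wfT  : WellFormedTBox T
      sat  : Consistent T (listABox A₀)
      ruleActs : All (λ r → proj₁ r ∈ Γ) Π

  KState : Set₂
  KState = ABox × SMap

  KABStep : TBox → List Rule → KState → KState → Set₂
  KABStep T Π (A , m) (A' , m') =
    Σ Rule λ r → r ∈ Π × Σ (Fin (np (proj₁ r)) → ℕ) λ σ →
      AskTrue T A (proj₂ r) σ × Step T A m (proj₁ r) σ A' m'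

  ΥS : KAB → KBTS
  ΥS K = reachTS T KState proj₁ (listABox A₀ , emptyMap) (KABStep T Π)
    where open KAB K

  data Prog : Set where
    ε     : Prog
    pick  : (α : Action) → ECQ (np α) 0 → Prog
    _∣_   : Prog → Prog → Prog
    _⨾_   : Prog → Prog → Prog
    ifte  : ECQ 0 0 → Prog → Prog → Prog
    while : ECQ 0 0 → Prog → Prog

  record GKAB : Set₁ where
    field
      T   : TBox
      A₀  : List GAtom
      Γ   : List Action
      δ   : Prog
      wfT : WellFormedTBox T
      sat : Consistent T (listABox A₀)

  noPar : Fin 0 → ℕ
  noPar ()

  data Final (T : TBox) (A : ABox) : Prog → Set₁ where
    fε     : Final T A ε
    f∣ˡ    : ∀ {δ₁ δ₂} → Final T A δ₁ → Final T A (δ₁ ∣ δ₂)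
    f∣ʳ    : ∀ {δ₁ δ₂} → Final T A δ₂ → Final T A (δ₁ ∣ δ₂)
    f⨾     : ∀ {δ₁ δ₂} → Final T A δ₁ → Final T A δ₂ → Final T A (δ₁ ⨾ δ₂)
    fifT   : ∀ {φ δ₁ δ₂} → AskTrue T A φ noPar → Final T A δ₁ → Final T A (ifte φ δ₁ δ₂)
    fifF   : ∀ {φ δ₁ δ₂} → ¬ AskTrue T A φ noPar → Final T A δ₂ → Final T A (ifte φ δ₁ δ₂)
    fwhF   : ∀ {φ δ} → ¬ AskTrue T A φ noPar → Final T A (while φ δ)
    fwhT   : ∀ {φ δ} → AskTrue T A φ noPar → Final T A δ → Final T A (while φ δ)

  GConf : Set₂
  GConf = ABox × SMap × Prog

  data Exec (T : TBox) : GConf → GConf → Set₂ where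
    xpick : ∀ {A m A' m' α Q} (σ : Fin (np α) → ℕ) →
            AskTrue T A Q σ → Step T A m α σ A' m' →
            Exec T (A , m , pick α Q) (A' , m' , ε)
    x∣ˡ   : ∀ {A m δ₁ δ₂ c'} → Exec T (A , m , δ₁) c' → Exec T (A , m , δ₁ ∣ δ₂) c'
    x∣ʳ   : ∀ {A m δ₁ δ₂ c'} → Exec T (A , m , δ₂) c' → Exec T (A , m , δ₁ ∣ δ₂) c'
    x⨾₁   : ∀ {A m A' m' δ₁ δ₁' δ₂} → Exec T (A , m , δ₁) (A' , m' , δ₁') →
            Exec T (A , m , δ₁ ⨾ δ₂) (A' , m' , δ₁' ⨾ δ₂)
    x⨾₂   : ∀ {A m δ₁ δ₂ c'} → Final T A δ₁ → Exec T (A , m , δ₂) c' →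
            Exec T (A , m , δ₁ ⨾ δ₂) c'
    xifT  : ∀ {A m φ δ₁ δ₂ c'} → AskTrue T A φ noPar → Exec T (A , m , δ₁) c' →
            Exec T (A , m , ifte φ δ₁ δ₂) c'
    xifF  : ∀ {A m φ δ₁ δ₂ c'} → ¬ AskTrue T A φ noPar → Exec T (A , m , δ₂) c' →
            Exec T (A , m , ifte φ δ₁ δ₂) c'
    xwh   : ∀ {A m A' m' φ δ δ'} → AskTrue T A φ noPar →
            Exec T (A , m , δ) (A' , m' , δ') →
            Exec T (A , m , while φ δ) (A' , m' , δ' ⨾ while φ δ)

  ΥfS : GKAB → KBTS
  ΥfS G = reachTS T GConf proj₁ (listABox A₀ , emptyMap , δ) (Exec T)
    where open GKAB G

  -- a₁ | ⋯ | aₙ  (right-nested; the empty choice is ε)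
  choice : List Prog → Prog
  choice []           = ε
  choice (a ∷ [])     = a
  choice (a ∷ b ∷ as) = a ∣ choice (b ∷ as)

  τK : KAB → GKAB
  τK K = record
    { T   = T
    ; A₀  = A₀
    ; Γ   = Γ
    ; δ   = while trueQ (choice (map (λ r → pick (proj₁ r) (proj₂ r)) Π))
    ; wfT = wfT
    ; sat = sat
    }
    where open KAB K

module Submission where

-- The Golog program τ_K(K) = while true do (a₁ | ⋯ | aₙ) simulates the
-- KAB K step for step: one iteration of the loop fires exactly one pick
-- aᵢ = pick Qᵢ.αᵢ, which is exactly one application of the rule
-- Qᵢ ↦ αᵢ, and afterwards the program is back at the loop, in the
-- residual form ε ; while true do (…).
--
-- The E-bisimulation then relates the KAB state ⟨A,m⟩ to the Golog
-- configurations ⟨A,m,p⟩ with p at the head of the main loop, and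
-- mainTheorem7 follows.

open import Defs
open import Data.Nat using (ℕ)
open import Data.Fin using (Fin)
open import Data.List using (List; _∷_; []; map)
open import Data.List.Membership.Propositional using (find; lose)
open import Data.List.Relation.Unary.Any using (Any; here; there)
import Data.List.Relation.Unary.Any.Properties as Any
open import Data.List.Relation.Unary.All using ([])
open import Data.Product using (Σ; _×_; _,_)
open import Relation.Binary.PropositionalEquality using (_≡_; refl)

module Simulation (nF : ℕ) (ar : Fin nF → ℕ) where
  open DL nF ar

  -- The trivially true query, the guard of the main loop of τ_K, holds
  -- in every KB: its only CQ has an empty body.
  trueQ-holds : ∀ {T A} → AskTrue T A trueQ noPar
  trueQ-holds I M = here ((λ ()) , [])

  _▹_ : KState → Prog → GConf
  (A , m) ▹ p = A , m , p

  pickOf : Rule → Prog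
  pickOf (α , Q) = pick α Q

  -- The rule Q ↦ α fires from ⟨A,m⟩ to ⟨A',m'⟩ for some parameters σ;
  -- KABStep T Π s s' unfolds to  Σ r (r ∈ Π × Fires T r s s').
  Fires : TBox → Rule → KState → KState → Set₂
  Fires T (α , Q) (A , m) (A' , m') =
    Σ (Fin (np α) → ℕ) λ σ → AskTrue T A Q σ × Step T A m α σ A' m'

  pick-exec⁻ : ∀ {T s c} (r : Rule) → Exec T (s ▹ pickOf r) c →
    Σ KState λ s' → Fires T r s s' × c ≡ s' ▹ ε
  pick-exec⁻ {s = A , m} (α , Q) (xpick σ ask step) = _ , (σ , ask , step) , refl

  pick-exec⁺ : ∀ {T s s'} (r : Rule) → Fires T r s s' →
    Exec T (s ▹ pickOf r) (s' ▹ ε)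
  pick-exec⁺ {s = A , m} {s' = A' , m'} (α , Q) (σ , ask , step) = xpick σ ask step

  choice-exec⁻ : ∀ {T s c} (ps : List Prog) → Exec T (s ▹ choice ps) c →
    Any (λ p → Exec T (s ▹ p) c) ps
  choice-exec⁻ {s = A , m} (p ∷ [])     e       = here e
  choice-exec⁻ {s = A , m} (p ∷ q ∷ ps) (x∣ˡ e) = here e
  choice-exec⁻ {s = A , m} (p ∷ q ∷ ps) (x∣ʳ e) = there (choice-exec⁻ (q ∷ ps) e)

  choice-exec⁺ : ∀ {T s c} (ps : List Prog) → Any (λ p → Exec T (s ▹ p) c) ps →
    Exec T (s ▹ choice ps) c
  choice-exec⁺ {s = A , m} (p ∷ [])     (here e)  = e
  choice-exec⁺ {s = A , m} (p ∷ q ∷ ps) (here e)  = x∣ˡ e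
  choice-exec⁺ {s = A , m} (p ∷ q ∷ ps) (there e) = x∣ʳ (choice-exec⁺ (q ∷ ps) e)

  rules : List Rule → Prog
  rules Π = choice (map pickOf Π)

  rules-exec⁻ : ∀ {T s c} (Π : List Rule) → Exec T (s ▹ rules Π) c →
    Σ KState λ s' → KABStep T Π s s' × c ≡ s' ▹ ε
  rules-exec⁻ Π e with find (Any.map⁻ (choice-exec⁻ (map pickOf Π) e))
  ... | r , r∈Π , e-r with pick-exec⁻ r e-r
  ...   | s' , fires , refl = s' , (r , r∈Π , fires) , refl

  rules-exec⁺ : ∀ {T s s'} (Π : List Rule) → KABStep T Π s s' →
    Exec T (s ▹ rules Π) (s' ▹ ε)
  rules-exec⁺ Π (r , r∈Π , fires) =
    choice-exec⁺ (map pickOf Π) (Any.map⁺ (lose r∈Π (pick-exec⁺ r fires)))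

  _⨾ᶜ_ : GConf → Prog → GConf
  (A , m , δ) ⨾ᶜ w = A , m , δ ⨾ w

  -- The two shapes a program has when control is at the head of the
  -- loop w: before its first iteration, and after a completed one.
  data AtLoop (w : Prog) : Prog → Set where
    loop-start  : AtLoop w w
    loop-resume : AtLoop w (ε ⨾ w)

  loop-exec⁻ : ∀ {T s c φ δ p} → AtLoop (while φ δ) p → Exec T (s ▹ p) c →
    Σ GConf λ c' → Exec T (s ▹ δ) c' × c ≡ c' ⨾ᶜ while φ δ
  loop-exec⁻ {s = A , m} loop-start  (xwh _ e)         = _ , e , refl
  loop-exec⁻ {s = A , m} loop-resume (x⨾₁ ())
  loop-exec⁻ {s = A , m} loop-resume (x⨾₂ _ (xwh _ e)) = _ , e , refl

  loop-exec⁺ : ∀ {T A m c φ δ p} → AskTrue T A φ noPar →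
    AtLoop (while φ δ) p → Exec T ((A , m) ▹ δ) c →
    Exec T ((A , m) ▹ p) (c ⨾ᶜ while φ δ)
  loop-exec⁺ {c = A' , m' , δ'} guard loop-start  e = xwh guard e
  loop-exec⁺ {c = A' , m' , δ'} guard loop-resume e = x⨾₂ fε (xwh guard e)

  module Bisimulation (K : KAB) where
    open KAB K

    mainLoop : Prog
    mainLoop = while trueQ (rules Π)

    Υ₁ : KBTS
    Υ₁ = ΥS K

    Υ₂ : KBTS
    Υ₂ = ΥfS (τK K)

    Related : KBTS.St Υ₁ → KBTS.St Υ₂ → Set₂
    Related (s , _) (c , _) = Σ Prog λ p → AtLoop mainLoop p × c ≡ s ▹ p

    forth : ∀ {s₁ s₂ s₁'} → Related s₁ s₂ → KBTS._⇒_ Υ₁ s₁ s₁' →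
      Σ (KBTS.St Υ₂) λ s₂' → KBTS._⇒_ Υ₂ s₂ s₂' × Related s₁' s₂'
    forth {s₁ = (A , m) , _} {s₂ = _ , reach₂} {s₁' = s' , _} (p , at , refl) step =
      (s' ▹ (ε ⨾ mainLoop) , next reach₂ iteration) , iteration ,
      (ε ⨾ mainLoop , loop-resume , refl)
      where
      iteration : Exec T ((A , m) ▹ p) (s' ▹ (ε ⨾ mainLoop))
      iteration = loop-exec⁺ trueQ-holds at (rules-exec⁺ Π step)

    back : ∀ {s₁ s₂ s₂'} → Related s₁ s₂ → KBTS._⇒_ Υ₂ s₂ s₂' →
      Σ (KBTS.St Υ₁) λ s₁' → KBTS._⇒_ Υ₁ s₁ s₁' × Related s₁' s₂'
    back {s₁ = s , reach₁} (_ , at , refl) e with loop-exec⁻ at e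
    ... | c' , e-body , refl with rules-exec⁻ Π e-body
    ...   | s' , step , refl =
      (s' , next reach₁ step) , step , (ε ⨾ mainLoop , loop-resume , refl)

    -- A transition of Υ₁ or Υ₂ only constrains the underlying states,
    -- not their reachability witnesses, so these are passed explicitly.
    isEBisim : IsEBisim Υ₁ Υ₂ Related
    isEBisim = record
      { aboxEq = λ { (_ , _ , refl) → refl }
      ; forth  = λ {s₁ s₂ s₁'} → forth {s₁} {s₂} {s₁'}
      ; back   = λ {s₁ s₂ s₂'} → back {s₁} {s₂} {s₂'}
      }

    equivalent : Υ₁ ∼E Υ₂
    equivalent = Related , isEBisim , (mainLoop , loop-start , refl)

mainTheorem7 : (nF : ℕ) (ar : Fin nF → ℕ) (K : DL.KAB nF ar) →
    DL._∼E_ nF ar (DL.ΥS nF ar K) (DL.ΥfS nF ar (DL.τK nF ar K))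
mainTheorem7 nF ar K = Simulation.Bisimulation.equivalent nF ar K
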